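{- Let $n\ge1$, $c\ge0$, and $P \in \widetilde{L}^{+}_{n,n,c+1}$. If $\operatorname{area}(P)=a$ and $\operatorname{dinv}(P)=b$, then $$a + b + \binom{c+1}{2} \leq \binom{n}{2}.$$
   Context: A Schröder path of size $n$ is a lattice path from $(0,0)$ to $(n,n)$ using North steps $(0,1)$, East steps $(1,0)$ and diagonal steps $(1,1)$, staying weakly above $y=x$. $\widetilde{L}^{+}_{n,n,d}$ is the set of such paths with $n-d$ North steps, $n-d$ East steps and $d$ diagonal steps, such that no diagonal step occurs after (above) the highest North step. $\operatorname{area}(P)$ is the number of full unit cells between $y=x$ and the Dyck path obtained from $P$ by replacing each diagonal step by a North step followed by an East step. A North step from $(i,j)$ to $(i,j+1)$ lies in the $(j-i)$-diagonal and in column $i$. Two North steps are attacking if they lie in the same diagonal, or they lie in consecutive diagonals and the one in a strictly further-left column lies in the higher diagonal. $\operatorname{dinv}(P)$ is the number of attacking pairs of North steps of $P$. -}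

module Defs where

open import Data.Nat using (ℕ; zero; suc; _+_; _∸_; _≤_; _<_; _≟_; _<?_)
open import Data.List using (List; []; _∷_; length; filter; sum; map)
open import Data.Product using (_×_; _,_)
open import Data.Sum using (_⊎_)
open import Data.Bool using (Bool; true; false; _∨_; _∧_)
open import Data.Unit using (⊤)
open import Data.Empty using (⊥)
open import Relation.Nullary.Decidable using (⌊_⌋)
open import Relation.Binary.PropositionalEquality using (_≡_)

-- Steps of a Schröder path: North (0,1), East (1,0), Diagonal (1,1).
data Step : Set where
  N E D : Step

countN countE countD : List Step → ℕ
countN []       = 0
countN (N ∷ s)  = suc (countN s)
countN (_ ∷ s)  = countN s
countE []       = 0
countE (E ∷ s)  = suc (countE s)
countE (_ ∷ s)  = countE s
countD []       = 0
countD (D ∷ s)  = suc (countD s)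
countD (_ ∷ s)  = countD s

AboveFrom : ℕ → ℕ → List Step → Set
AboveFrom x y []      = ⊤
AboveFrom x y (N ∷ s) = AboveFrom x (suc y) s
AboveFrom x y (E ∷ s) = suc x ≤ y × AboveFrom (suc x) y s
AboveFrom x y (D ∷ s) = AboveFrom (suc x) (suc y) s

hasN : List Step → Bool
hasN []      = false
hasN (N ∷ s) = true
hasN (_ ∷ s) = hasN s

-- No diagonal step occurs after the highest (= last) North step.
-- (If the path has no North step at all, the condition holds vacuously.)
NoDAfterLastN : List Step → Set
NoDAfterLastN []      = ⊤
NoDAfterLastN (N ∷ s) = NoDAfterLastN s
NoDAfterLastN (E ∷ s) = NoDAfterLastN s
NoDAfterLastN (D ∷ s) = HasN s × NoDAfterLastN s
  where
  HasN : List Step → Set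
  HasN t with hasN t
  ... | true  = ⊤
  ... | false = ⊥

-- The set  L̃⁺_{n,n,d} : Schröder paths of size n with n-d North,
-- n-d East and d diagonal steps, staying weakly above y = x,
-- with no diagonal step after the highest North step.
-- (The endpoint (n,n) follows from the step counts.)
record InL (n d : ℕ) (P : List Step) : Set where
  field
    d≤n      : d ≤ n
    numN     : countN P ≡ n ∸ d
    numE     : countE P ≡ n ∸ d
    numD     : countD P ≡ d
    above    : AboveFrom 0 0 P
    noDAfter : NoDAfterLastN P

northStepsFrom : ℕ → ℕ → List Step → List (ℕ × ℕ)
northStepsFrom x y []      = []
northStepsFrom x y (N ∷ s) = (x , y) ∷ northStepsFrom x (suc y) s
northStepsFrom x y (E ∷ s) = northStepsFrom (suc x) y s
northStepsFrom x y (D ∷ s) = northStepsFrom (suc x) (suc y) s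

-- Area: number of full unit cells between y = x and the Dyck path obtained
-- by replacing each D by N E.  Row by row: a North step of the Dyck path
-- from (i , j) to (i , j+1) contributes the j - i full cells to its right
-- in that row.  The North steps of the Dyck path start at the starting
-- points of the N and D steps of P.
areaFrom : ℕ → ℕ → List Step → ℕ
areaFrom x y []      = 0
areaFrom x y (N ∷ s) = (y ∸ x) + areaFrom x (suc y) s
areaFrom x y (E ∷ s) = areaFrom (suc x) y s
areaFrom x y (D ∷ s) = (y ∸ x) + areaFrom (suc x) (suc y) s

area : List Step → ℕ
area = areaFrom 0 0

-- A North step from (i , j) lies in diagonal j - i and column i.
-- attacking (i₁ , j₁) (i₂ , j₂): same diagonal, or consecutive diagonals
-- where the one in the strictly further-left column is in the higher one.
attacking : ℕ × ℕ → ℕ × ℕ → Bool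
attacking (i₁ , j₁) (i₂ , j₂) =
  ⌊ (j₁ ∸ i₁) ≟ (j₂ ∸ i₂) ⌋
  ∨ (⌊ (j₁ ∸ i₁) ≟ suc (j₂ ∸ i₂) ⌋ ∧ ⌊ i₁ <? i₂ ⌋)
  ∨ (⌊ (j₂ ∸ i₂) ≟ suc (j₁ ∸ i₁) ⌋ ∧ ⌊ i₂ <? i₁ ⌋)

countPairs : List (ℕ × ℕ) → ℕ
countPairs []       = 0
countPairs (p ∷ ps) = length (filter (λ q → attacking p q Data.Bool.≟ true) ps) + countPairs ps

dinv : List Step → ℕ
dinv P = countPairs (northStepsFrom 0 0 P)

{-# OPTIONS --safe #-}
module Submission where

open import Defs
open import Data.Nat using (ℕ; zero; suc; _+_; _*_; _∸_; _≤_; _<_; _⊓_; z≤n; s≤s; _<?_; _≟_)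
open import Data.Nat.Properties
open import Data.Nat.Combinatorics using (_C_; nC1≡n; nCk+nC[k+1]≡[n+1]C[k+1])
open import Data.Nat.Solver using (module +-*-Solver)
open import Algebra.Properties.CommutativeSemigroup +-commutativeSemigroup using (interchange; xy∙z≈xz∙y)
open import Data.List using (List; []; _∷_; _++_; _∷ʳ_; [_]; length; filter)
open import Data.List.Properties using (length-++; filter-++; filter-accept; filter-reject; ++-identityʳ)
open import Data.List.Relation.Unary.All as All using (All; []; _∷_)
open import Data.List.Reverse using (Reverse; []; _∶_∶ʳ_; reverseView)
open import Data.Bool using (true; false) renaming (_≟_ to _≟ᵇ_)
open import Data.Product using (_×_; _,_; proj₁; uncurry)
open import Level using (Level)
open import Relation.Nullary using (¬_; yes; no; contradiction)
open import Relation.Unary using (Pred; Decidable)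
open import Relation.Binary.PropositionalEquality using (_≡_; refl; sym; trans; cong; cong₂; subst; module ≡-Reasoning)

-- Build the path step by step, keeping track of n North and d diagonal steps.
-- An East step changes neither area nor dinv.  A diagonal or North step taken
-- from a point at height L = y - x above the diagonal adds L to the area, and a
-- North step also adds the number k of earlier North steps attacking it.  The
-- height rises only along North steps, one unit at a time, so among the earlier
-- North steps there is one in each diagonal 0, ..., L - 1; none of these attacks
-- the new step, which lies weakly to the right of all of them.  Hence L + k <= n,
-- which gives area + dinv <= C(n,2) + n d, and C(n,2) + n d + C(d,2) = C(n+d,2).

[1+m]∸n≤1+[m∸n] : ∀ m n → suc m ∸ n ≤ suc (m ∸ n)
[1+m]∸n≤1+[m∸n] m       zero    = ≤-refl
[1+m]∸n≤1+[m∸n] zero    (suc n) = ≤-trans (m∸n≤m 0 n) z≤n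
[1+m]∸n≤1+[m∸n] (suc m) (suc n) = [1+m]∸n≤1+[m∸n] m n

[1+n]C2≡nC2+n : ∀ n → suc n C 2 ≡ n C 2 + n
[1+n]C2≡nC2+n n = begin
  suc n C 2      ≡⟨ sym (nCk+nC[k+1]≡[n+1]C[k+1] n 1) ⟩
  n C 1 + n C 2  ≡⟨ cong (_+ n C 2) (nC1≡n n) ⟩
  n + n C 2      ≡⟨ +-comm n (n C 2) ⟩
  n C 2 + n      ∎
  where open ≡-Reasoning

module _ {a p q : Level} {A : Set a} {P : Pred A p} {Q : Pred A q}
         (P? : Decidable P) (Q? : Decidable Q) where

  length-filter-disjoint : ∀ {xs} → All (λ x → P x → ¬ Q x) xs →
    length (filter P? xs) + length (filter Q? xs) ≤ length xs
  length-filter-disjoint [] = z≤n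
  length-filter-disjoint {x ∷ xs} (disj ∷ disjs) with P? x | Q? x
  ... | yes px | yes qx = contradiction qx (disj px)
  ... | yes _  | no _   = s≤s (length-filter-disjoint disjs)
  ... | no _   | yes _  = ≤-trans (≤-reflexive (+-suc _ _)) (s≤s (length-filter-disjoint disjs))
  ... | no _   | no _   = m≤n⇒m≤1+n (length-filter-disjoint disjs)

length-filter-++ : ∀ {a p} {A : Set a} {P : Pred A p} (P? : Decidable P) xs ys →
  length (filter P? (xs ++ ys)) ≡ length (filter P? xs) + length (filter P? ys)
length-filter-++ P? xs ys = trans (cong length (filter-++ P? xs ys)) (length-++ (filter P? xs))

capacity : ℕ → ℕ → ℕ
capacity n d = n C 2 + n * d

capacity-sucˡ : ∀ n d → capacity (suc n) d ≡ capacity n d + (n + d)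
capacity-sucˡ n d = begin
  suc n C 2 + (d + n * d)      ≡⟨ cong (_+ (d + n * d)) ([1+n]C2≡nC2+n n) ⟩
  n C 2 + n + (d + n * d)      ≡⟨ solve 4 (λ c n d nd → c :+ n :+ (d :+ nd) := c :+ nd :+ (n :+ d))
                                        refl (n C 2) n d (n * d) ⟩
  n C 2 + n * d + (n + d)      ∎
  where
  open ≡-Reasoning
  open +-*-Solver

capacity-sucʳ : ∀ n d → capacity n (suc d) ≡ capacity n d + n
capacity-sucʳ n d = begin
  n C 2 + n * suc d    ≡⟨ cong (n C 2 +_) (trans (*-suc n d) (+-comm n (n * d))) ⟩
  n C 2 + (n * d + n)  ≡⟨ sym (+-assoc (n C 2) (n * d) n) ⟩
  n C 2 + n * d + n    ∎
  where open ≡-Reasoning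

capacity+C2≡[n+d]C2 : ∀ n d → capacity n d + d C 2 ≡ (n + d) C 2
capacity+C2≡[n+d]C2 zero    d = refl
capacity+C2≡[n+d]C2 (suc n) d = begin
  capacity (suc n) d + d C 2      ≡⟨ cong (_+ d C 2) (capacity-sucˡ n d) ⟩
  capacity n d + (n + d) + d C 2  ≡⟨ xy∙z≈xz∙y (capacity n d) (n + d) (d C 2) ⟩
  capacity n d + d C 2 + (n + d)  ≡⟨ cong (_+ (n + d)) (capacity+C2≡[n+d]C2 n d) ⟩
  (n + d) C 2 + (n + d)           ≡⟨ sym ([1+n]C2≡nC2+n (n + d)) ⟩
  suc (n + d) C 2                 ∎
  where open ≡-Reasoning

endpoint : ℕ → ℕ → List Step → ℕ × ℕ
endpoint x y []      = x , y
endpoint x y (N ∷ s) = endpoint x (suc y) s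
endpoint x y (E ∷ s) = endpoint (suc x) y s
endpoint x y (D ∷ s) = endpoint (suc x) (suc y) s

diag : ℕ × ℕ → ℕ
diag (i , j) = j ∸ i

height : List Step → ℕ
height s = diag (endpoint 0 0 s)

northStepsFrom-++ : ∀ x y s t → northStepsFrom x y (s ++ t)
  ≡ northStepsFrom x y s ++ uncurry northStepsFrom (endpoint x y s) t
northStepsFrom-++ x y []      t = refl
northStepsFrom-++ x y (N ∷ s) t = cong ((x , y) ∷_) (northStepsFrom-++ x (suc y) s t)
northStepsFrom-++ x y (E ∷ s) t = northStepsFrom-++ (suc x) y s t
northStepsFrom-++ x y (D ∷ s) t = northStepsFrom-++ (suc x) (suc y) s t

areaFrom-++ : ∀ x y s t → areaFrom x y (s ++ t)
  ≡ areaFrom x y s + uncurry areaFrom (endpoint x y s) t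
areaFrom-++ x y []      t = refl
areaFrom-++ x y (N ∷ s) t =
  trans (cong (y ∸ x +_) (areaFrom-++ x (suc y) s t)) (sym (+-assoc (y ∸ x) _ _))
areaFrom-++ x y (E ∷ s) t = areaFrom-++ (suc x) y s t
areaFrom-++ x y (D ∷ s) t =
  trans (cong (y ∸ x +_) (areaFrom-++ (suc x) (suc y) s t)) (sym (+-assoc (y ∸ x) _ _))

-- Stated as [ t ] + s so that it computes to suc or to the identity once t is known.
countN-∷ʳ : ∀ s t → countN (s ∷ʳ t) ≡ countN [ t ] + countN s
countN-∷ʳ []      t = sym (+-identityʳ _)
countN-∷ʳ (N ∷ s) t = trans (cong suc (countN-∷ʳ s t)) (sym (+-suc _ _))
countN-∷ʳ (E ∷ s) t = countN-∷ʳ s t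
countN-∷ʳ (D ∷ s) t = countN-∷ʳ s t

countD-∷ʳ : ∀ s t → countD (s ∷ʳ t) ≡ countD [ t ] + countD s
countD-∷ʳ []      t = sym (+-identityʳ _)
countD-∷ʳ (N ∷ s) t = countD-∷ʳ s t
countD-∷ʳ (E ∷ s) t = countD-∷ʳ s t
countD-∷ʳ (D ∷ s) t = trans (cong suc (countD-∷ʳ s t)) (sym (+-suc _ _))

length-northStepsFrom : ∀ x y s → length (northStepsFrom x y s) ≡ countN s
length-northStepsFrom x y []      = refl
length-northStepsFrom x y (N ∷ s) = cong suc (length-northStepsFrom x (suc y) s)
length-northStepsFrom x y (E ∷ s) = length-northStepsFrom (suc x) y s
length-northStepsFrom x y (D ∷ s) = length-northStepsFrom (suc x) (suc y) s

x≤endpoint₁ : ∀ x y s → x ≤ proj₁ (endpoint x y s)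
x≤endpoint₁ x y []      = ≤-refl
x≤endpoint₁ x y (N ∷ s) = x≤endpoint₁ x (suc y) s
x≤endpoint₁ x y (E ∷ s) = m+n≤o⇒n≤o 1 (x≤endpoint₁ (suc x) y s)
x≤endpoint₁ x y (D ∷ s) = m+n≤o⇒n≤o 1 (x≤endpoint₁ (suc x) (suc y) s)

northStepsFrom-leftOf-endpoint : ∀ x y s →
  All (λ p → proj₁ p ≤ proj₁ (endpoint x y s)) (northStepsFrom x y s)
northStepsFrom-leftOf-endpoint x y []      = []
northStepsFrom-leftOf-endpoint x y (N ∷ s) =
  x≤endpoint₁ x (suc y) s ∷ northStepsFrom-leftOf-endpoint x (suc y) s
northStepsFrom-leftOf-endpoint x y (E ∷ s) = northStepsFrom-leftOf-endpoint (suc x) y s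
northStepsFrom-leftOf-endpoint x y (D ∷ s) = northStepsFrom-leftOf-endpoint (suc x) (suc y) s

below? : (T : ℕ) → Decidable (λ p → diag p < T)
below? T p = diag p <? T

northStepsBelow : ℕ → List (ℕ × ℕ) → List (ℕ × ℕ)
northStepsBelow T = filter (below? T)

module _ (T : ℕ) where
  open ≤-Reasoning

  -- Only North steps raise the diagonal index, by at most one; capping at T
  -- discards exactly the rises of North steps lying in diagonals >= T.
  endDiag⊓-≤-northStepsBelow : ∀ x y s → diag (endpoint x y s) ⊓ T
    ≤ diag (x , y) ⊓ T + length (northStepsBelow T (northStepsFrom x y s))
  endDiag⊓-≤-northStepsBelow x y [] = m≤m+n _ _
  endDiag⊓-≤-northStepsBelow x y (N ∷ s) with diag (x , y) <? T
  ... | yes h<T = begin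
    diag (endpoint x (suc y) s) ⊓ T  ≤⟨ endDiag⊓-≤-northStepsBelow x (suc y) s ⟩
    diag (x , suc y) ⊓ T + c         ≤⟨ +-monoˡ-≤ c (m⊓n≤m _ T) ⟩
    diag (x , suc y) + c             ≤⟨ +-monoˡ-≤ c ([1+m]∸n≤1+[m∸n] y x) ⟩
    suc (diag (x , y)) + c           ≡⟨ cong (λ h → suc h + c) (sym (m≤n⇒m⊓n≡m (<⇒≤ h<T))) ⟩
    suc (diag (x , y) ⊓ T) + c       ≡⟨ sym (+-suc _ c) ⟩
    diag (x , y) ⊓ T + suc c         ≡⟨ cong (λ ps → diag (x , y) ⊓ T + length ps) (sym (filter-accept (below? T) h<T)) ⟩
    diag (x , y) ⊓ T + length (northStepsBelow T ((x , y) ∷ northStepsFrom x (suc y) s)) ∎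
    where c = length (northStepsBelow T (northStepsFrom x (suc y) s))
  ... | no h≮T = begin
    diag (endpoint x (suc y) s) ⊓ T  ≤⟨ endDiag⊓-≤-northStepsBelow x (suc y) s ⟩
    diag (x , suc y) ⊓ T + c         ≤⟨ +-monoˡ-≤ c (m⊓n≤n _ T) ⟩
    T + c                            ≡⟨ cong (_+ c) (sym (m≥n⇒m⊓n≡n (≮⇒≥ h≮T))) ⟩
    diag (x , y) ⊓ T + c             ≡⟨ cong (λ ps → diag (x , y) ⊓ T + length ps) (sym (filter-reject (below? T) h≮T)) ⟩
    diag (x , y) ⊓ T + length (northStepsBelow T ((x , y) ∷ northStepsFrom x (suc y) s)) ∎
    where c = length (northStepsBelow T (northStepsFrom x (suc y) s))
  endDiag⊓-≤-northStepsBelow x y (E ∷ s) =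
    ≤-trans (endDiag⊓-≤-northStepsBelow (suc x) y s)
            (+-monoˡ-≤ _ (⊓-monoˡ-≤ T (∸-monoʳ-≤ y (n≤1+n x))))
  endDiag⊓-≤-northStepsBelow x y (D ∷ s) = endDiag⊓-≤-northStepsBelow (suc x) (suc y) s

height≤northStepsBelow : ∀ s → height s ≤ length (northStepsBelow (height s) (northStepsFrom 0 0 s))
height≤northStepsBelow s =
  subst (_≤ length (northStepsBelow (height s) (northStepsFrom 0 0 s))) (⊓-idem (height s))
    (endDiag⊓-≤-northStepsBelow (height s) 0 0 s)

attacking-leftOf⇒diag≤ : ∀ {i j X Y} → i ≤ X → attacking (i , j) (X , Y) ≡ true →
  diag (X , Y) ≤ diag (i , j)
attacking-leftOf⇒diag≤ {i} {j} {X} {Y} i≤X att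
  with (j ∸ i) ≟ (Y ∸ X) | (j ∸ i) ≟ suc (Y ∸ X) | (Y ∸ X) ≟ suc (j ∸ i) | X <? i
... | yes same | _          | _     | _      = ≤-reflexive (sym same)
... | no _     | yes higher | _     | _      = ≤-trans (n≤1+n _) (≤-reflexive (sym higher))
... | no _     | no _       | _     | yes X<i = contradiction i≤X (<⇒≱ X<i)
... | no _     | no _       | yes _ | no _   = contradiction att λ ()
... | no _     | no _       | no _  | no _   = contradiction att λ ()

attackersOf : ℕ × ℕ → List (ℕ × ℕ) → List (ℕ × ℕ)
attackersOf q = filter (λ p → attacking p q ≟ᵇ true)

attackersAtEnd : List Step → ℕ
attackersAtEnd s = length (attackersOf (endpoint 0 0 s) (northStepsFrom 0 0 s))

height+attackers≤countN : ∀ s → height s + attackersAtEnd s ≤ countN s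
height+attackers≤countN s = begin
  height s + attackersAtEnd s
    ≤⟨ +-monoˡ-≤ (attackersAtEnd s) (height≤northStepsBelow s) ⟩
  length (northStepsBelow (height s) ns) + attackersAtEnd s
    ≤⟨ length-filter-disjoint (below? (height s)) (λ p → attacking p (endpoint 0 0 s) ≟ᵇ true)
         (All.map belowCannotAttack (northStepsFrom-leftOf-endpoint 0 0 s)) ⟩
  length ns
    ≡⟨ length-northStepsFrom 0 0 s ⟩
  countN s ∎
  where
  open ≤-Reasoning
  ns = northStepsFrom 0 0 s
  belowCannotAttack : ∀ {p} → proj₁ p ≤ proj₁ (endpoint 0 0 s) →
    diag p < height s → ¬ attacking p (endpoint 0 0 s) ≡ true
  belowCannotAttack leftOf below att = <⇒≱ below (attacking-leftOf⇒diag≤ leftOf att)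

targetsOf : ℕ × ℕ → List (ℕ × ℕ) → List (ℕ × ℕ)
targetsOf p = filter (λ r → attacking p r ≟ᵇ true)

length-targetsOf-[q]≡length-attackersOf-[p] : ∀ p q →
  length (targetsOf p [ q ]) ≡ length (attackersOf q [ p ])
length-targetsOf-[q]≡length-attackersOf-[p] p q with attacking p q
... | true  = refl
... | false = refl

countPairs-∷ʳ : ∀ ps q → countPairs (ps ∷ʳ q) ≡ countPairs ps + length (attackersOf q ps)
countPairs-∷ʳ []       q = refl
countPairs-∷ʳ (p ∷ ps) q = begin
  length (targetsOf p (ps ∷ʳ q)) + countPairs (ps ∷ʳ q)
    ≡⟨ cong₂ _+_ (length-filter-++ _ ps [ q ]) (countPairs-∷ʳ ps q) ⟩
  (length (targetsOf p ps) + length (targetsOf p [ q ])) + (countPairs ps + length (attackersOf q ps))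
    ≡⟨ interchange (length (targetsOf p ps)) _ (countPairs ps) _ ⟩
  countPairs (p ∷ ps) + (length (targetsOf p [ q ]) + length (attackersOf q ps))
    ≡⟨ cong (λ k → countPairs (p ∷ ps) + (k + length (attackersOf q ps)))
            (length-targetsOf-[q]≡length-attackersOf-[p] p q) ⟩
  countPairs (p ∷ ps) + (length (attackersOf q [ p ]) + length (attackersOf q ps))
    ≡⟨ cong (countPairs (p ∷ ps) +_) (sym (length-filter-++ _ [ p ] ps)) ⟩
  countPairs (p ∷ ps) + length (attackersOf q (p ∷ ps)) ∎
  where open ≡-Reasoning

area-∷ʳ-N : ∀ s → area (s ∷ʳ N) ≡ area s + height s
area-∷ʳ-N s = trans (areaFrom-++ 0 0 s [ N ]) (cong (area s +_) (+-identityʳ (height s)))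

area-∷ʳ-E : ∀ s → area (s ∷ʳ E) ≡ area s
area-∷ʳ-E s = trans (areaFrom-++ 0 0 s [ E ]) (+-identityʳ (area s))

area-∷ʳ-D : ∀ s → area (s ∷ʳ D) ≡ area s + height s
area-∷ʳ-D s = trans (areaFrom-++ 0 0 s [ D ]) (cong (area s +_) (+-identityʳ (height s)))

dinv-∷ʳ-N : ∀ s → dinv (s ∷ʳ N) ≡ dinv s + attackersAtEnd s
dinv-∷ʳ-N s = trans (cong countPairs (northStepsFrom-++ 0 0 s [ N ]))
                    (countPairs-∷ʳ (northStepsFrom 0 0 s) (endpoint 0 0 s))

dinv-∷ʳ-E : ∀ s → dinv (s ∷ʳ E) ≡ dinv s
dinv-∷ʳ-E s = cong countPairs (trans (northStepsFrom-++ 0 0 s [ E ]) (++-identityʳ _))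

dinv-∷ʳ-D : ∀ s → dinv (s ∷ʳ D) ≡ dinv s
dinv-∷ʳ-D s = cong countPairs (trans (northStepsFrom-++ 0 0 s [ D ]) (++-identityʳ _))

WithinCapacity : List Step → Set
WithinCapacity s = area s + dinv s ≤ capacity (countN s) (countD s)

withinCapacity-∷ʳ : ∀ s t → WithinCapacity s → WithinCapacity (s ∷ʳ t)
withinCapacity-∷ʳ s N ih = begin
  area (s ∷ʳ N) + dinv (s ∷ʳ N)                   ≡⟨ cong₂ _+_ (area-∷ʳ-N s) (dinv-∷ʳ-N s) ⟩
  area s + height s + (dinv s + attackersAtEnd s) ≡⟨ interchange (area s) (height s) (dinv s) _ ⟩
  area s + dinv s + (height s + attackersAtEnd s) ≤⟨ +-mono-≤ ih (height+attackers≤countN s) ⟩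
  capacity (countN s) (countD s) + countN s       ≤⟨ +-monoʳ-≤ _ (m≤m+n (countN s) (countD s)) ⟩
  capacity (countN s) (countD s) + (countN s + countD s) ≡⟨ sym (capacity-sucˡ (countN s) (countD s)) ⟩
  capacity (suc (countN s)) (countD s)            ≡⟨ sym (cong₂ capacity (countN-∷ʳ s N) (countD-∷ʳ s N)) ⟩
  capacity (countN (s ∷ʳ N)) (countD (s ∷ʳ N))    ∎
  where open ≤-Reasoning
withinCapacity-∷ʳ s E ih = begin
  area (s ∷ʳ E) + dinv (s ∷ʳ E)                   ≡⟨ cong₂ _+_ (area-∷ʳ-E s) (dinv-∷ʳ-E s) ⟩
  area s + dinv s                                 ≤⟨ ih ⟩
  capacity (countN s) (countD s)                  ≡⟨ sym (cong₂ capacity (countN-∷ʳ s E) (countD-∷ʳ s E)) ⟩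
  capacity (countN (s ∷ʳ E)) (countD (s ∷ʳ E))    ∎
  where open ≤-Reasoning
withinCapacity-∷ʳ s D ih = begin
  area (s ∷ʳ D) + dinv (s ∷ʳ D)                   ≡⟨ cong₂ _+_ (area-∷ʳ-D s) (dinv-∷ʳ-D s) ⟩
  area s + height s + dinv s                      ≡⟨ xy∙z≈xz∙y (area s) (height s) (dinv s) ⟩
  area s + dinv s + height s                      ≤⟨ +-mono-≤ ih (m+n≤o⇒m≤o (height s) (height+attackers≤countN s)) ⟩
  capacity (countN s) (countD s) + countN s       ≡⟨ sym (capacity-sucʳ (countN s) (countD s)) ⟩
  capacity (countN s) (suc (countD s))            ≡⟨ sym (cong₂ capacity (countN-∷ʳ s D) (countD-∷ʳ s D)) ⟩
  capacity (countN (s ∷ʳ D)) (countD (s ∷ʳ D))    ∎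
  where open ≤-Reasoning

withinCapacity : ∀ s → WithinCapacity s
withinCapacity s = go (reverseView s)
  where
  go : ∀ {s} → Reverse s → WithinCapacity s
  go []             = z≤n
  go (s ∶ r ∶ʳ t)   = withinCapacity-∷ʳ s t (go r)

theorem4p14 : (n c : ℕ) → 1 ≤ n → (P : List Step) → InL n (suc c) P →
    (a b : ℕ) → area P ≡ a → dinv P ≡ b →
    a + b + (suc c C 2) ≤ n C 2
theorem4p14 n c _ P P∈L _ _ refl refl = begin
  area P + dinv P + suc c C 2                ≤⟨ +-monoˡ-≤ (suc c C 2) (withinCapacity P) ⟩
  capacity (countN P) (countD P) + suc c C 2 ≡⟨ cong (λ d → capacity (countN P) (countD P) + d C 2) (sym numD) ⟩
  capacity (countN P) (countD P) + countD P C 2 ≡⟨ capacity+C2≡[n+d]C2 (countN P) (countD P) ⟩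
  (countN P + countD P) C 2                  ≡⟨ cong (_C 2) (trans (cong₂ _+_ numN numD) (m∸n+n≡m d≤n)) ⟩
  n C 2                                      ∎
  where
  open ≤-Reasoning
  open InL P∈L
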